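{- Let $n$ be odd and $\lambda=(\frac{n+1}{2},1^{\frac{n-1}{2}})$. A standard Young tableau $P$ of shape $\lambda$ satisfies $\epsilon(P)^T=P$ if and only if for every $i\in[n]$ with $i>1$, $i$ lying in the first row of $P$ implies that $n-i+2$ lies in the first column of $P$.
   Context: $T^T$ denotes the transpose. Evacuation $\epsilon$: for a tableau $Q$ with minimal entry $m$ in cell $\alpha$, $\Delta Q$ is obtained by erasing $m$ and performing a forward jeu de taquin slide into $\alpha$ (repeatedly move into the empty cell the smaller of the entries immediately to its right and immediately below it, until the empty cell has neither, and then delete it). For $Q$ standard with $n$ entries, $\epsilon(Q)$ is the tableau of the same shape whose cell $\beta$ contains $n-i$ where $\beta$ is the cell vacated in passing from $\Delta^iQ$ to $\Delta^{i+1}Q$, $0\le i\le n-1$. -}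

module Defs where

open import Data.Nat using (ℕ; zero; suc; _+_; _*_; _∸_; _<_; _<ᵇ_)
open import Data.Bool using (if_then_else_)
open import Data.List using (List; []; _∷_; map; concat; length; mapMaybe; upTo; replicate; applyUpTo)
open import Data.Maybe using (Maybe; just; nothing)
open import Data.Product using (_×_; _,_)
open import Data.List.Relation.Unary.All using (All)
open import Data.List.Relation.Unary.Linked using (Linked)
open import Data.List.Relation.Binary.Permutation.Propositional using (_↭_)
open import Relation.Binary.PropositionalEquality using (_≡_)

-- A tableau is given by its list of rows (top to bottom, English notation).
-- Cell (r , c) is row r, column c, both 0-indexed.
Tab : Set
Tab = List (List ℕ)

lookupL : {A : Set} → List A → ℕ → Maybe A
lookupL []       _       = nothing
lookupL (x ∷ xs) zero    = just x
lookupL (x ∷ xs) (suc i) = lookupL xs i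

entry : Tab → ℕ → ℕ → Maybe ℕ
entry T r c with lookupL T r
... | nothing  = nothing
... | just row = lookupL row c

modifyAt : {A : Set} → ℕ → (A → A) → List A → List A
modifyAt _       f []       = []
modifyAt zero    f (x ∷ xs) = f x ∷ xs
modifyAt (suc i) f (x ∷ xs) = x ∷ modifyAt i f xs

removeAt : {A : Set} → ℕ → List A → List A
removeAt _       []       = []
removeAt zero    (x ∷ xs) = xs
removeAt (suc i) (x ∷ xs) = x ∷ removeAt i xs

setCell : Tab → ℕ → ℕ → ℕ → Tab
setCell T r c v = modifyAt r (modifyAt c (λ _ → v)) T

dropEmpty : Tab → Tab
dropEmpty []            = []
dropEmpty ([] ∷ rs)     = dropEmpty rs
dropEmpty ((x ∷ r) ∷ rs) = (x ∷ r) ∷ dropEmpty rs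

deleteCell : Tab → ℕ → ℕ → Tab
deleteCell T r c = dropEmpty (modifyAt r (removeAt c) T)

shape : Tab → List ℕ
shape = map length

size : Tab → ℕ
size T = length (concat T)

-- Forward jeu de taquin slide into the empty cell (r , c) (its stored
-- value is irrelevant).  The fuel argument bounds the number of moves
-- (size T moves always suffice).
slide : ℕ → Tab → ℕ → ℕ → Tab × (ℕ × ℕ)
slide zero T r c = deleteCell T r c , (r , c)
slide (suc f) T r c with entry T r (suc c) | entry T (suc r) c
... | nothing | nothing = deleteCell T r c , (r , c)
... | just x  | nothing = slide f (setCell T r c x) r (suc c)
... | nothing | just y  = slide f (setCell T r c y) (suc r) c
... | just x  | just y  =
  if x <ᵇ y then slide f (setCell T r c x) r (suc c)
            else slide f (setCell T r c y) (suc r) c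

cellsRow : ℕ → ℕ → List ℕ → List (ℕ × ℕ × ℕ)
cellsRow r c []       = []
cellsRow r c (x ∷ xs) = (r , c , x) ∷ cellsRow r (suc c) xs

cellsFrom : ℕ → Tab → List (ℕ × ℕ × ℕ)
cellsFrom r []         = []
cellsFrom r (row ∷ rs) = Data.List._++_ (cellsRow r 0 row) (cellsFrom (suc r) rs)

minCellL : List (ℕ × ℕ × ℕ) → Maybe (ℕ × ℕ × ℕ)
minCellL [] = nothing
minCellL (p ∷ ps) with minCellL ps
... | nothing = just p
... | just q@(_ , _ , w) with p
...   | (_ , _ , v) = if w <ᵇ v then just q else just p

minCell : Tab → Maybe (ℕ × ℕ)
minCell T with minCellL (cellsFrom 0 T)
... | nothing = nothing
... | just (r , c , _) = just (r , c)

-- Δ Q : erase the minimal entry and slide into its cell; also returns the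
-- cell vacated in passing from Q to Δ Q.  (nothing for the empty tableau)
delta : Tab → Maybe (Tab × (ℕ × ℕ))
delta T with minCell T
... | nothing = nothing
... | just (r , c) = just (slide (size T) T r c)

-- evacuation: the cell vacated in passing from Δ^i Q to Δ^{i+1} Q receives n - i
evacAux : ℕ → ℕ → ℕ → Tab → Tab → Tab
evacAux zero    i n D R = R
evacAux (suc f) i n D R with delta D
... | nothing = R
... | just (D' , (r , c)) = evacAux f (suc i) n D' (setCell R r c (n ∸ i))

evac : Tab → Tab
evac Q = evacAux (size Q) 0 (size Q) Q (map (map (λ _ → 0)) Q)

firstRow : Tab → List ℕ
firstRow []         = []
firstRow (row ∷ rs) = row

transposeT : Tab → Tab
transposeT T = map (λ j → mapMaybe (λ row → lookupL row j) T) (upTo (length (firstRow T)))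

headL : List ℕ → Maybe ℕ
headL []      = nothing
headL (x ∷ _) = just x

firstCol : Tab → List ℕ
firstCol T = mapMaybe headL T

IsPartition : List ℕ → Set
IsPartition μ = All (λ m → 0 < m) μ × Linked (λ a b → b Data.Nat.≤ a) μ

IsSYT : ℕ → Tab → Set
IsSYT n T =
  IsPartition (shape T) ×
  All (Linked _<_) T ×
  (∀ r c x y → entry T r c ≡ just x → entry T (suc r) c ≡ just y → x < y) ×
  (concat T ↭ applyUpTo suc n)

hook : ℕ → List ℕ
hook k = suc k ∷ replicate k 1

{-# OPTIONS --safe #-}
-- A standard tableau P of hook shape (k+1, 1^k) has 1 in its corner; let S be the rest of its
-- first row and T the rest of its first column, so S and T partition {2, …, n}. Each step Δ of
-- evacuation removes the corner and slides the smaller of its two neighbours into it, after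
-- which the rest of that arm (or leg) shifts one cell towards the corner. So every Δ^i P is a
-- hook, and the cell vacated is the end of the arm when the removed minimum c lies in S and the
-- end of the leg when it lies in T; it receives n + 2 − c. Hence the arm and leg of ε(P) are
-- S and T reflected by c ↦ n + 2 − c (and reversed), and, the reflection being an involution,
-- ε(P)^T = P iff the reflection of S is T. Both are increasing lists of length k, so this
-- holds iff the reflection maps S into T.
module Submission where

open import Defs
open import Data.Bool using (true; false)
open import Data.Nat
  using (ℕ; zero; suc; _+_; _*_; _∸_; _<_; _≤_; _>_; _<ᵇ_; z≤n; s≤s; s≤s⁻¹)
open import Data.Nat.Properties
open import Data.Maybe using (just; nothing; maybe′)
import Data.Maybe.Relation.Unary.All as Maybe
open import Data.Product using (_×_; _,_; proj₂; Σ-syntax)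
open import Data.Sum using (inj₁; inj₂)
open import Data.List
  using (List; []; _∷_; [_]; _++_; map; concat; length; replicate; reverse; applyUpTo; mapMaybe)
open import Data.List.Properties
  using ( ∷-injectiveˡ; ∷-injectiveʳ; ++-assoc; ++-identityʳ
        ; length-++; length-++-≤ˡ; length-++-≤ʳ; length-map; length-reverse
        ; map-injective; map-∘; map-id-local; map-applyUpTo; concat-map-[_]
        ; unfold-reverse; reverse-map; reverse-involutive )
open import Data.List.Relation.Unary.All as All using (All; []; _∷_)
open import Data.List.Relation.Unary.All.Properties using (++⁺; map⁺)
open import Data.List.Relation.Unary.AllPairs using (AllPairs; []; _∷_; tail)
import Data.List.Relation.Unary.AllPairs.Properties as AllPairs
open import Data.List.Relation.Unary.Any using (here; there)
open import Data.List.Relation.Unary.Any.Properties using (reverse⁺; reverse⁻)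
open import Data.List.Relation.Unary.Linked using (Linked; []; [-]; _∷_)
open import Data.List.Relation.Unary.Linked.Properties using (Linked⇒AllPairs)
open import Data.List.Membership.Propositional using (_∈_)
open import Data.List.Membership.Propositional.Properties
  using (∈-map⁺; ∈-map⁻; ∈-++⁺ˡ; ∈-++⁺ʳ; ∈-++⁻)
open import Data.List.Relation.Binary.Permutation.Propositional using (_↭_; ↭-sym; ↭-trans)
open import Data.List.Relation.Binary.Permutation.Propositional.Properties
  using (∈-resp-↭; drop-∷; shift; ¬x∷xs↭[])
open import Data.List.Relation.Binary.Sublist.Propositional as Sublist using (_∷ʳ_)
open import Data.List.Relation.Binary.Sublist.Propositional.Properties using (to-≋)
open import Data.List.Relation.Binary.Equality.Propositional using (≋⇒≡)
open import Function.Base using (id; const; _∘_; flip)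
open import Function.Bundles using (_⇔_; mk⇔)
open import Function.Properties.Equivalence using () renaming (trans to ⇔-trans)
open import Relation.Nullary.Reflects using (ofʸ; ofⁿ)
open import Relation.Nullary.Negation using (contradiction)
open import Relation.Binary.PropositionalEquality hiding ([_])

lookupL-after : ∀ {A : Set} (pre : List A) h ys →
  lookupL (pre ++ h ∷ ys) (suc (length pre)) ≡ lookupL ys 0
lookupL-after []        h ys = refl
lookupL-after (_ ∷ pre) h ys = lookupL-after pre h ys

modifyAt-++ : ∀ {A : Set} (pre : List A) f h ys →
  modifyAt (length pre) f (pre ++ h ∷ ys) ≡ pre ++ f h ∷ ys
modifyAt-++ []        f h ys = refl
modifyAt-++ (p ∷ pre) f h ys = cong (p ∷_) (modifyAt-++ pre f h ys)

removeAt-++ : ∀ {A : Set} (pre : List A) h ys → removeAt (length pre) (pre ++ h ∷ ys) ≡ pre ++ ys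
removeAt-++ []        h ys = refl
removeAt-++ (p ∷ pre) h ys = cong (p ∷_) (removeAt-++ pre h ys)

length-∷ʳ : ∀ {A : Set} (xs : List A) x → length (xs ++ [ x ]) ≡ suc (length xs)
length-∷ʳ xs x = trans (length-++ xs) (+-comm (length xs) 1)

modifyAt-replicate : ∀ {A : Set} m (v a : A) xs →
  modifyAt m (const v) (replicate (suc m) a ++ xs) ≡ replicate m a ++ v ∷ xs
modifyAt-replicate zero    v a xs = refl
modifyAt-replicate (suc m) v a xs = cong (a ∷_) (modifyAt-replicate m v a xs)

reverse-∷-++ : ∀ {A : Set} (xs : List A) x ys → reverse (x ∷ xs) ++ ys ≡ reverse xs ++ x ∷ ys
reverse-∷-++ xs x ys = trans (cong (_++ ys) (unfold-reverse x xs)) (++-assoc (reverse xs) [ x ] ys)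

map-const : ∀ {A B : Set} (a : B) (xs : List A) → map (const a) xs ≡ replicate (length xs) a
map-const a []       = refl
map-const a (x ∷ xs) = cong (a ∷_) (map-const a xs)

-- Hook tableaux

hookTab : ℕ → List ℕ → List ℕ → Tab
hookTab x arm leg = (x ∷ arm) ∷ map [_] leg

hookTab-injective : ∀ {c c' S S' T T'} → hookTab c S T ≡ hookTab c' S' T' → S ≡ S' × T ≡ T'
hookTab-injective eq =
  ∷-injectiveʳ (∷-injectiveˡ eq) , map-injective ∷-injectiveˡ (∷-injectiveʳ eq)

firstCol-hookTab : ∀ c S T → firstCol (hookTab c S T) ≡ c ∷ T
firstCol-hookTab c S T = cong (c ∷_) (heads T)
  where
  heads : ∀ (T : List ℕ) → mapMaybe headL (map [_] T) ≡ T
  heads []      = refl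
  heads (t ∷ T) = cong (t ∷_) (heads T)

column₀-singletons : ∀ (T : List ℕ) → mapMaybe (λ row → lookupL row 0) (map [_] T) ≡ T
column₀-singletons []      = refl
column₀-singletons (t ∷ T) = cong (t ∷_) (column₀-singletons T)

column-suc-singletons : ∀ j (T : List ℕ) →
  mapMaybe (λ row → lookupL row (suc j)) (map [_] T) ≡ []
column-suc-singletons j []      = refl
column-suc-singletons j (t ∷ T) = column-suc-singletons j T

arm-columns : ∀ (S : List ℕ) (G : ℕ → List ℕ) → (∀ j → G j ≡ []) →
  applyUpTo (λ j → maybe′ _∷_ id (lookupL S j) (G j)) (length S) ≡ map [_] S
arm-columns []      G G≡[] = refl
arm-columns (s ∷ S) G G≡[] =
  cong₂ _∷_ (cong (s ∷_) (G≡[] 0)) (arm-columns S (G ∘ suc) (G≡[] ∘ suc))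

transposeT-hookTab : ∀ c S T → transposeT (hookTab c S T) ≡ hookTab c T S
transposeT-hookTab c S T = trans (map-applyUpTo id column (suc (length S)))
  (cong₂ _∷_ (cong (c ∷_) (column₀-singletons T))
             (arm-columns S (λ j → mapMaybe (λ row → lookupL row (suc j)) (map [_] T))
                            (λ j → column-suc-singletons j T)))
  where
  column : ℕ → List ℕ
  column j = mapMaybe (λ row → lookupL row j) (hookTab c S T)

dropEmpty-singletons : ∀ l → dropEmpty (map [_] l) ≡ map [_] l
dropEmpty-singletons []      = refl
dropEmpty-singletons (x ∷ l) = cong ([ x ] ∷_) (dropEmpty-singletons l)

entry-leg : ∀ row l r → entry (row ∷ map [_] l) (suc r) 0 ≡ lookupL l r
entry-leg row []      r       = refl
entry-leg row (x ∷ l) zero    = refl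
entry-leg row (x ∷ l) (suc r) = entry-leg row l r

entry-right-of-leg : ∀ row l r j → entry (row ∷ map [_] l) (suc r) (suc j) ≡ nothing
entry-right-of-leg row []      r       j = refl
entry-right-of-leg row (x ∷ l) zero    j = refl
entry-right-of-leg row (x ∷ l) (suc r) j = entry-right-of-leg row l r j

modifyAt-singletons : ∀ (l : List ℕ) r v →
  modifyAt r (modifyAt 0 (const v)) (map [_] l) ≡ map [_] (modifyAt r (const v) l)
modifyAt-singletons []      r       v = refl
modifyAt-singletons (x ∷ l) zero    v = refl
modifyAt-singletons (x ∷ l) (suc r) v = cong ([ x ] ∷_) (modifyAt-singletons l r v)

deleteLast-singletons : ∀ (pre : List ℕ) h →
  dropEmpty (modifyAt (length pre) (removeAt 0) (map [_] (pre ++ [ h ]))) ≡ map [_] pre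
deleteLast-singletons []        h = refl
deleteLast-singletons (p ∷ pre) h = cong ([ p ] ∷_) (deleteLast-singletons pre h)

entry-column₀ : ∀ x S T r → entry (hookTab x S T) r 0 ≡ lookupL (x ∷ T) r
entry-column₀ x S T zero    = refl
entry-column₀ x S T (suc r) = entry-leg (x ∷ S) T r

size-hookTab : ∀ x S T → size (hookTab x S T) ≡ suc (length S + length T)
size-hookTab x S T =
  cong suc (trans (length-++ S) (cong (λ l → length S + length l) (concat-map-[ T ])))

length-leg≤ : ∀ (S T : List ℕ) → length T ≤ length (S ++ concat (map [_] T))
length-leg≤ S T =
  subst (λ l → length l ≤ length (S ++ concat (map [_] T))) (concat-map-[ T ])
        (length-++-≤ʳ (concat (map [_] T)) {S})

data HookShaped (k : ℕ) : Tab → Set where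
  hookShaped : ∀ x {S T} → length S ≡ k → length T ≡ k → HookShaped k (hookTab x S T)

singleton-rows : ∀ (rows : Tab) k → map length rows ≡ replicate k 1 →
  Σ[ T ∈ List ℕ ] rows ≡ map [_] T × length T ≡ k
singleton-rows []                  zero    _  = [] , refl , refl
singleton-rows ((t ∷ []) ∷ rows)   (suc k) eq with singleton-rows rows k (∷-injectiveʳ eq)
... | T , refl , |T|≡k = t ∷ T , refl , cong suc |T|≡k
singleton-rows ([] ∷ rows)         (suc k) eq with () ← ∷-injectiveˡ eq
singleton-rows ((_ ∷ _ ∷ _) ∷ rows) (suc k) eq with () ← ∷-injectiveˡ eq

hook-shaped : ∀ {P k} → shape P ≡ hook k → HookShaped k P
hook-shaped {(x ∷ S) ∷ rows} {k} eq with singleton-rows rows k (∷-injectiveʳ eq)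
... | T , refl , |T|≡k = hookShaped x (suc-injective (∷-injectiveˡ eq)) |T|≡k
hook-shaped {[] ∷ rows} eq with () ← ∷-injectiveˡ eq

Increasing : List ℕ → Set
Increasing = AllPairs _<_

head-≤ : ∀ {a c S} → Increasing (a ∷ S) → c ∈ a ∷ S → a ≤ c
head-≤ _         (here refl) = ≤-refl
head-≤ (a<S ∷ _) (there c∈S) = <⇒≤ (All.lookup a<S c∈S)

bounded-head : ∀ {a c S} → Increasing (a ∷ S) → c ∈ a ∷ S → c ≤ a → a ≡ c
bounded-head S↑ c∈ c≤a = ≤-antisym (head-≤ S↑ c∈) c≤a

∈-tail : ∀ {z y : ℕ} {ys} → z ∈ y ∷ ys → y ≢ z → z ∈ ys
∈-tail (here refl) y≢z = contradiction refl y≢z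
∈-tail (there z∈)  _   = z∈

increasing-⊆⇒sublist : ∀ {xs ys} → Increasing xs → Increasing ys → (∀ {z} → z ∈ xs → z ∈ ys) →
  xs Sublist.⊆ ys
increasing-⊆⇒sublist {[]}     {[]}     _   _   _   = Sublist.[]
increasing-⊆⇒sublist {x ∷ _}  {[]}     _   _   xs⊆ with () ← xs⊆ (here refl)
increasing-⊆⇒sublist {[]}     {y ∷ ys} _   (_ ∷ ys↑) _ = y ∷ʳ increasing-⊆⇒sublist [] ys↑ (λ ())
increasing-⊆⇒sublist {x ∷ xs} {y ∷ ys} xs↑@(x<xs ∷ xs'↑) (y<ys ∷ ys↑) xs⊆ with xs⊆ (here refl)
... | here refl   = refl Sublist.∷ increasing-⊆⇒sublist xs'↑ ys↑
                      (λ z∈ → ∈-tail (xs⊆ (there z∈)) (<⇒≢ (All.lookup x<xs z∈)))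
... | there x∈ys  = y ∷ʳ increasing-⊆⇒sublist xs↑ ys↑
                      (λ z∈ → ∈-tail (xs⊆ z∈)
                                (<⇒≢ (<-≤-trans (All.lookup y<ys x∈ys) (head-≤ xs↑ z∈))))

increasing-⊆⇒≡ : ∀ {xs ys} → Increasing xs → Increasing ys → (∀ {z} → z ∈ xs → z ∈ ys) →
  length xs ≡ length ys → xs ≡ ys
increasing-⊆⇒≡ xs↑ ys↑ xs⊆ len = ≋⇒≡ (to-≋ len (increasing-⊆⇒sublist xs↑ ys↑ xs⊆))

AllPairs-reverse⁺ : ∀ {A : Set} {R : A → A → Set} {xs} →
  AllPairs R xs → AllPairs (flip R) (reverse xs)
AllPairs-reverse⁺ {xs = []}     []          = []
AllPairs-reverse⁺ {xs = x ∷ xs} (x~xs ∷ xs~) rewrite unfold-reverse x xs =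
  AllPairs.++⁺ (AllPairs-reverse⁺ xs~) ([] ∷ [])
    (All.tabulate (λ y∈ → All.lookup x~xs (reverse⁻ y∈) ∷ []))

map-∸-decreasing : ∀ N {xs} → Increasing xs → All (_≤ N) xs → AllPairs _>_ (map (N ∸_) xs)
map-∸-decreasing N []           []          = []
map-∸-decreasing N (x<xs ∷ xs↑) (_ ∷ xs≤N) =
  map⁺ (All.tabulate (λ z∈ → ∸-monoʳ-< (All.lookup x<xs z∈) (All.lookup xs≤N z∈)))
  ∷ map-∸-decreasing N xs↑ xs≤N

reverse-map-∸-increasing : ∀ N {xs} → Increasing xs → All (_≤ N) xs →
  Increasing (reverse (map (N ∸_) xs))
reverse-map-∸-increasing N xs↑ xs≤N = AllPairs-reverse⁺ (map-∸-decreasing N xs↑ xs≤N)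

map-∸-involutive : ∀ N {xs} → All (_≤ N) xs → map (N ∸_) (map (N ∸_) xs) ≡ xs
map-∸-involutive N {xs} xs≤N = trans (sym (map-∘ xs)) (map-id-local (All.map m∸[m∸n]≡n xs≤N))

reverse-map-∸-involutive : ∀ N {xs} → All (_≤ N) xs →
  reverse (map (N ∸_) (reverse (map (N ∸_) xs))) ≡ xs
reverse-map-∸-involutive N {xs} xs≤N = begin
    reverse (map (N ∸_) (reverse (map (N ∸_) xs)))
  ≡⟨ cong reverse (reverse-map (N ∸_) (map (N ∸_) xs)) ⟩
    reverse (reverse (map (N ∸_) (map (N ∸_) xs)))
  ≡⟨ reverse-involutive _ ⟩
    map (N ∸_) (map (N ∸_) xs)
  ≡⟨ map-∸-involutive N xs≤N ⟩
    xs
  ∎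
  where open ≡-Reasoning

reverse-map-∸≡⇔ : ∀ N {S T} → Increasing S → Increasing T → All (_≤ N) S → length S ≡ length T →
  reverse (map (N ∸_) S) ≡ T ⇔ (∀ {i} → i ∈ S → N ∸ i ∈ T)
reverse-map-∸≡⇔ N {S} {T} S↑ T↑ S≤N |S|≡|T| = mk⇔ to from
  where
  to : reverse (map (N ∸_) S) ≡ T → ∀ {i} → i ∈ S → N ∸ i ∈ T
  to refl i∈S = reverse⁺ (∈-map⁺ (N ∸_) i∈S)
  from : (∀ {i} → i ∈ S → N ∸ i ∈ T) → reverse (map (N ∸_) S) ≡ T
  from S→T = increasing-⊆⇒≡ (reverse-map-∸-increasing N S↑ S≤N) T↑ image⊆
    (trans (length-reverse (map (N ∸_) S)) (trans (length-map (N ∸_) S) |S|≡|T|))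
    where
    image⊆ : ∀ {z} → z ∈ reverse (map (N ∸_) S) → z ∈ T
    image⊆ z∈ with ∈-map⁻ (N ∸_) (reverse⁻ {xs = map (N ∸_) S} z∈)
    ... | i , i∈S , refl = S→T i∈S

range : ℕ → ℕ → List ℕ
range c zero    = []
range c (suc L) = c ∷ range (suc c) L

range-lower : ∀ {z} c L → z ∈ range c L → c ≤ z
range-lower c (suc L) (here refl) = ≤-refl
range-lower c (suc L) (there z∈) = ≤-trans (n≤1+n c) (range-lower (suc c) L z∈)

range-upper : ∀ {z} c L → z ∈ range c L → z < c + L
range-upper c (suc L) (here refl) = subst (c <_) (sym (+-suc c L)) (s≤s (m≤m+n c L))
range-upper {z} c (suc L) (there z∈) = subst (z <_) (sym (+-suc c L)) (range-upper (suc c) L z∈)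

range-bounds : ∀ {z} c L → z ∈ range (suc c) L → c < z × z ≤ c + L
range-bounds c L z∈ = range-lower (suc c) L z∈ , s≤s⁻¹ (range-upper (suc c) L z∈)

applyUpTo-range : ∀ (f : ℕ → ℕ) c L → (∀ i → f i ≡ c + i) → applyUpTo f L ≡ range c L
applyUpTo-range f c zero    _      = refl
applyUpTo-range f c (suc L) f≡c+ =
  cong₂ _∷_ (trans (f≡c+ 0) (+-identityʳ c))
    (applyUpTo-range (f ∘ suc) (suc c) L (λ i → trans (f≡c+ (suc i)) (+-suc c i)))

-- Jeu de taquin in a hook

module _ (f : ℕ) (Q : Tab) (r c : ℕ) where

  slide-stop : entry Q r (suc c) ≡ nothing → entry Q (suc r) c ≡ nothing →
    slide (suc f) Q r c ≡ (deleteCell Q r c , r , c)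
  slide-stop e₁ e₂ rewrite e₁ | e₂ = refl

  slide-right : ∀ {x} → entry Q r (suc c) ≡ just x → entry Q (suc r) c ≡ nothing →
    slide (suc f) Q r c ≡ slide f (setCell Q r c x) r (suc c)
  slide-right e₁ e₂ rewrite e₁ | e₂ = refl

  slide-down : ∀ {y} → entry Q r (suc c) ≡ nothing → entry Q (suc r) c ≡ just y →
    slide (suc f) Q r c ≡ slide f (setCell Q r c y) (suc r) c
  slide-down e₁ e₂ rewrite e₁ | e₂ = refl

  slide-right-past : ∀ {x y} → entry Q r (suc c) ≡ just x → entry Q (suc r) c ≡ just y → x < y →
    slide (suc f) Q r c ≡ slide f (setCell Q r c x) r (suc c)
  slide-right-past {x} {y} e₁ e₂ x<y rewrite e₁ | e₂ with x <ᵇ y | <ᵇ-reflects-< x y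
  ... | true  | _       = refl
  ... | false | ofⁿ x≮y = contradiction x<y x≮y

  slide-down-past : ∀ {x y} → entry Q r (suc c) ≡ just x → entry Q (suc r) c ≡ just y → y ≤ x →
    slide (suc f) Q r c ≡ slide f (setCell Q r c y) (suc r) c
  slide-down-past {x} {y} e₁ e₂ y≤x rewrite e₁ | e₂ with x <ᵇ y | <ᵇ-reflects-< x y
  ... | false | _       = refl
  ... | true  | ofʸ x<y = contradiction y≤x (<⇒≱ x<y)

slide-along-arm : ∀ f y pre h xs leg → length xs ≤ f →
  slide f (((y ∷ pre) ++ h ∷ xs) ∷ map [_] leg) 0 (suc (length pre)) ≡
    (((y ∷ pre) ++ xs) ∷ map [_] leg , 0 , suc (length pre + length xs))
slide-along-arm zero y pre h [] leg _
  rewrite removeAt-++ pre h [] | dropEmpty-singletons leg | +-identityʳ (length pre) = refl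
slide-along-arm (suc f) y pre h [] leg _
  rewrite slide-stop f (((y ∷ pre) ++ [ h ]) ∷ map [_] leg) 0 (suc (length pre))
            (lookupL-after pre h []) (entry-right-of-leg ((y ∷ pre) ++ [ h ]) leg 0 (length pre))
        | removeAt-++ pre h [] | dropEmpty-singletons leg | +-identityʳ (length pre) = refl
slide-along-arm (suc f) y pre h (x ∷ xs) leg (s≤s len≤f) = begin
    slide (suc f) (((y ∷ pre) ++ h ∷ x ∷ xs) ∷ map [_] leg) 0 (suc (length pre))
  ≡⟨ slide-right f (((y ∷ pre) ++ h ∷ x ∷ xs) ∷ map [_] leg) 0 (suc (length pre))
       (lookupL-after pre h (x ∷ xs))
       (entry-right-of-leg ((y ∷ pre) ++ h ∷ x ∷ xs) leg 0 (length pre)) ⟩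
    slide f ((y ∷ modifyAt (length pre) (const x) (pre ++ h ∷ x ∷ xs)) ∷ map [_] leg) 0 (suc (suc (length pre)))
  ≡⟨ cong₂ (λ row j → slide f ((y ∷ row) ∷ map [_] leg) 0 (suc j))
       (trans (modifyAt-++ pre (const x) h (x ∷ xs)) (sym (++-assoc pre [ x ] (x ∷ xs))))
       (sym (length-∷ʳ pre x)) ⟩
    slide f ((y ∷ (pre ++ [ x ]) ++ x ∷ xs) ∷ map [_] leg) 0 (suc (length (pre ++ [ x ])))
  ≡⟨ slide-along-arm f y (pre ++ [ x ]) x xs leg len≤f ⟩
    ((y ∷ (pre ++ [ x ]) ++ xs) ∷ map [_] leg , 0 , suc (length (pre ++ [ x ]) + length xs))
  ≡⟨ cong₂ (λ row j → ((y ∷ row) ∷ map [_] leg , 0 , suc j))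
       (++-assoc pre [ x ] xs)
       (trans (cong (_+ length xs) (length-∷ʳ pre x)) (sym (+-suc (length pre) (length xs)))) ⟩
    (((y ∷ pre) ++ x ∷ xs) ∷ map [_] leg , 0 , suc (length pre + length (x ∷ xs)))
  ∎
  where open ≡-Reasoning

slide-down-leg : ∀ f y row pre h xs → length xs ≤ f →
  slide f ((y ∷ row) ∷ map [_] (pre ++ h ∷ xs)) (suc (length pre)) 0 ≡
    ((y ∷ row) ∷ map [_] (pre ++ xs) , suc (length pre + length xs) , 0)
slide-down-leg zero y row pre h [] _
  rewrite deleteLast-singletons pre h | ++-identityʳ pre | +-identityʳ (length pre) = refl
slide-down-leg (suc f) y row pre h [] _
  rewrite slide-stop f ((y ∷ row) ∷ map [_] (pre ++ [ h ])) (suc (length pre)) 0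
            (entry-right-of-leg (y ∷ row) (pre ++ [ h ]) (length pre) 0)
            (trans (entry-leg (y ∷ row) (pre ++ [ h ]) (suc (length pre))) (lookupL-after pre h []))
        | deleteLast-singletons pre h | ++-identityʳ pre | +-identityʳ (length pre) = refl
slide-down-leg (suc f) y row pre h (x ∷ xs) (s≤s len≤f) = begin
    slide (suc f) ((y ∷ row) ∷ map [_] (pre ++ h ∷ x ∷ xs)) (suc (length pre)) 0
  ≡⟨ slide-down f ((y ∷ row) ∷ map [_] (pre ++ h ∷ x ∷ xs)) (suc (length pre)) 0
       (entry-right-of-leg (y ∷ row) (pre ++ h ∷ x ∷ xs) (length pre) 0)
       (trans (entry-leg (y ∷ row) (pre ++ h ∷ x ∷ xs) (suc (length pre))) (lookupL-after pre h (x ∷ xs))) ⟩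
    slide f ((y ∷ row) ∷ modifyAt (length pre) (modifyAt 0 (const x)) (map [_] (pre ++ h ∷ x ∷ xs)))
      (suc (suc (length pre))) 0
  ≡⟨ cong (λ rows → slide f ((y ∷ row) ∷ rows) (suc (suc (length pre))) 0)
       (modifyAt-singletons (pre ++ h ∷ x ∷ xs) (length pre) x) ⟩
    slide f ((y ∷ row) ∷ map [_] (modifyAt (length pre) (const x) (pre ++ h ∷ x ∷ xs)))
      (suc (suc (length pre))) 0
  ≡⟨ cong₂ (λ l j → slide f ((y ∷ row) ∷ map [_] l) (suc j) 0)
       (trans (modifyAt-++ pre (const x) h (x ∷ xs)) (sym (++-assoc pre [ x ] (x ∷ xs))))
       (sym (length-∷ʳ pre x)) ⟩
    slide f ((y ∷ row) ∷ map [_] ((pre ++ [ x ]) ++ x ∷ xs)) (suc (length (pre ++ [ x ]))) 0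
  ≡⟨ slide-down-leg f y row (pre ++ [ x ]) x xs len≤f ⟩
    ((y ∷ row) ∷ map [_] ((pre ++ [ x ]) ++ xs) , suc (length (pre ++ [ x ]) + length xs) , 0)
  ≡⟨ cong₂ (λ l j → ((y ∷ row) ∷ map [_] l , suc j , 0))
       (++-assoc pre [ x ] xs)
       (trans (cong (_+ length xs) (length-∷ʳ pre x)) (sym (+-suc (length pre) (length xs)))) ⟩
    ((y ∷ row) ∷ map [_] (pre ++ x ∷ xs) , suc (length pre + length (x ∷ xs)) , 0)
  ∎
  where open ≡-Reasoning

value : ℕ × ℕ × ℕ → ℕ
value (_ , _ , v) = v

minCellL-all : ∀ {P : ℕ × ℕ × ℕ → Set} {cells} → All P cells → Maybe.All P (minCellL cells)
minCellL-all [] = Maybe.nothing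
minCellL-all {cells = (_ , _ , v) ∷ cells} (p ∷ ps) with minCellL cells | minCellL-all ps
... | nothing              | _          = Maybe.just p
... | just (_ , _ , w)     | Maybe.just q with w <ᵇ v
...   | true  = Maybe.just q
...   | false = Maybe.just p

minCellL-head : ∀ r c x cells → All (λ t → x < value t) cells →
  minCellL ((r , c , x) ∷ cells) ≡ just (r , c , x)
minCellL-head r c x cells x<cells with minCellL cells | minCellL-all x<cells
... | nothing          | _ = refl
... | just (_ , _ , w) | Maybe.just x<w with w <ᵇ x | <ᵇ-reflects-< w x
...   | false | _       = refl
...   | true  | ofʸ w<x = contradiction w<x (<⇒≯ x<w)

values-cellsRow : ∀ {P : ℕ → Set} r c {S} → All P S → All (λ t → P (value t)) (cellsRow r c S)
values-cellsRow r c []       = []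
values-cellsRow r c (p ∷ ps) = p ∷ values-cellsRow r (suc c) ps

values-cellsFrom-leg : ∀ {P : ℕ → Set} r {T} → All P T →
  All (λ t → P (value t)) (cellsFrom r (map [_] T))
values-cellsFrom-leg r []       = []
values-cellsFrom-leg r (p ∷ ps) = p ∷ values-cellsFrom-leg (suc r) ps

delta-hookTab : ∀ {x S T} → All (x <_) S → All (x <_) T →
  delta (hookTab x S T) ≡ just (slide (size (hookTab x S T)) (hookTab x S T) 0 0)
delta-hookTab {x} {S} {T} x<S x<T
  rewrite minCellL-head 0 0 x _ (++⁺ (values-cellsRow 0 1 x<S) (values-cellsFrom-leg 1 x<T)) = refl

first-move-arm : ∀ f x c S T → All (c <_) T →
  slide (suc f) (hookTab x (c ∷ S) T) 0 0 ≡ slide f ((c ∷ c ∷ S) ∷ map [_] T) 0 1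
first-move-arm f x c S []      _         = slide-right f (hookTab x (c ∷ S) []) 0 0 refl refl
first-move-arm f x c S (b ∷ T) (c<b ∷ _) =
  slide-right-past f (hookTab x (c ∷ S) (b ∷ T)) 0 0 refl refl c<b

-- On a tie `slide` moves the lower neighbour, hence the non-strict hypothesis.
first-move-leg : ∀ f x c S T → All (c ≤_) S →
  slide (suc f) (hookTab x S (c ∷ T)) 0 0 ≡ slide f ((c ∷ S) ∷ map [_] (c ∷ T)) 1 0
first-move-leg f x c []      T _         = slide-down f (hookTab x [] (c ∷ T)) 0 0 refl refl
first-move-leg f x c (a ∷ S) T (c≤a ∷ _) =
  slide-down-past f (hookTab x (a ∷ S) (c ∷ T)) 0 0 refl refl c≤a

delta-hookTab-arm : ∀ {x c S T} → All (x <_) (c ∷ S) → All (x <_) T → All (c <_) T →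
  delta (hookTab x (c ∷ S) T) ≡ just (hookTab c S T , 0 , suc (length S))
delta-hookTab-arm {x} {c} {S} {T} x<S x<T c<T = trans (delta-hookTab x<S x<T) (cong just (begin
    slide (suc f) (hookTab x (c ∷ S) T) 0 0
  ≡⟨ first-move-arm f x c S T c<T ⟩
    slide f ((c ∷ c ∷ S) ∷ map [_] T) 0 1
  ≡⟨ slide-along-arm f c [] c S T (≤-trans (length-++-≤ˡ S) (n≤1+n _)) ⟩
    (hookTab c S T , 0 , suc (length S))
  ∎))
  where
  open ≡-Reasoning
  f = suc (length (S ++ concat (map [_] T)))

delta-hookTab-leg : ∀ {x c S T} → All (x <_) S → All (x <_) (c ∷ T) → All (c ≤_) S →
  delta (hookTab x S (c ∷ T)) ≡ just (hookTab c S T , suc (length T) , 0)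
delta-hookTab-leg {x} {c} {S} {T} x<S x<T c≤S = trans (delta-hookTab x<S x<T) (cong just (begin
    slide (suc f) (hookTab x S (c ∷ T)) 0 0
  ≡⟨ first-move-leg f x c S T c≤S ⟩
    slide f ((c ∷ S) ∷ map [_] (c ∷ T)) 1 0
  ≡⟨ slide-down-leg f c S [] c T (≤-trans (n≤1+n (length T)) (length-leg≤ S (c ∷ T))) ⟩
    (hookTab c S T , suc (length T) , 0)
  ∎))
  where
  open ≡-Reasoning
  f = length (S ++ c ∷ concat (map [_] T))

data HookDelta (x c : ℕ) : List ℕ → List ℕ → Set where
  arm : ∀ {S T} → delta (hookTab x (c ∷ S) T) ≡ just (hookTab c S T , 0 , suc (length S)) →
        HookDelta x c (c ∷ S) T
  leg : ∀ {S T} → delta (hookTab x S (c ∷ T)) ≡ just (hookTab c S T , suc (length T) , 0) →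
        HookDelta x c S (c ∷ T)

hookDelta-at-min : ∀ {x c} S T → Increasing S → Increasing T → All (c ≤_) S → All (c ≤_) T →
  c ∈ S ++ T → x < c → HookDelta x c S T
hookDelta-at-min S []        S↑ T↑ c≤S c≤T c∈ x<c with ∈-++⁻ S c∈
hookDelta-at-min (a ∷ S) [] S↑ _ c≤S@(c≤a ∷ _) _ _ x<c | inj₁ c∈S with bounded-head S↑ c∈S c≤a
... | refl = arm (delta-hookTab-arm (All.map (<-≤-trans x<c) c≤S) [] [])
hookDelta-at-min S (b ∷ T) S↑ T↑@(b<T ∷ _) c≤S c≤T@(c≤b ∷ _) c∈ x<c with m≤n⇒m<n∨m≡n c≤b
... | inj₂ refl =
  leg (delta-hookTab-leg (All.map (<-≤-trans x<c) c≤S) (All.map (<-≤-trans x<c) c≤T) c≤S)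
... | inj₁ c<b with ∈-++⁻ S c∈
...   | inj₂ c∈T = contradiction (bounded-head T↑ c∈T c≤b) (<⇒≢ c<b ∘ sym)
hookDelta-at-min (a ∷ S) (b ∷ T) S↑ T↑@(b<T ∷ _) c≤S@(c≤a ∷ _) c≤T c∈ x<c
  | inj₁ c<b | inj₁ c∈S with bounded-head S↑ c∈S c≤a
... | refl = arm (delta-hookTab-arm (All.map (<-≤-trans x<c) c≤S) (All.map (<-≤-trans x<c) c≤T)
                   (c<b ∷ All.map (<-trans c<b) b<T))

hookDelta : ∀ {x c S T} L → Increasing S → Increasing T → S ++ T ↭ range c (suc L) → x < c →
  HookDelta x c S T
hookDelta {c = c} {S} {T} L S↑ T↑ S++T↭ =
  hookDelta-at-min S T S↑ T↑
    (All.tabulate (λ z∈S → range-lower c (suc L) (∈-resp-↭ S++T↭ (∈-++⁺ˡ z∈S))))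
    (All.tabulate (λ z∈T → range-lower c (suc L) (∈-resp-↭ S++T↭ (∈-++⁺ʳ S z∈T))))
    (∈-resp-↭ (↭-sym S++T↭) (here refl))

-- Evacuation of a hook

evacAux-step : ∀ {f i n D R D' r c} → delta D ≡ just (D' , r , c) →
  evacAux (suc f) i n D R ≡ evacAux f (suc i) n D' (setCell R r c (n ∸ i))
evacAux-step eq rewrite eq = refl

evacAux-[] : ∀ f i n R → evacAux f i n [] R ≡ R
evacAux-[] zero    i n R = refl
evacAux-[] (suc f) i n R = refl

module _ {f i n x c r : ℕ} {S T ra rb : List ℕ} where

  evacAux-arm-step : delta (hookTab x (c ∷ S) T) ≡ just (hookTab c S T , 0 , suc (length S)) →
    evacAux (suc f) i n (hookTab x (c ∷ S) T) (hookTab r (replicate (suc (length S)) 0 ++ ra) rb) ≡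
      evacAux f (suc i) n (hookTab c S T) (hookTab r (replicate (length S) 0 ++ n ∸ i ∷ ra) rb)
  evacAux-arm-step d = trans (evacAux-step d)
    (cong (λ arm → evacAux f (suc i) n (hookTab c S T) (hookTab r arm rb))
          (modifyAt-replicate (length S) (n ∸ i) 0 ra))

  evacAux-leg-step : delta (hookTab x S (c ∷ T)) ≡ just (hookTab c S T , suc (length T) , 0) →
    evacAux (suc f) i n (hookTab x S (c ∷ T)) (hookTab r ra (replicate (suc (length T)) 0 ++ rb)) ≡
      evacAux f (suc i) n (hookTab c S T) (hookTab r ra (replicate (length T) 0 ++ n ∸ i ∷ rb))
  evacAux-leg-step d = trans (evacAux-step d)
    (cong (λ legs → evacAux f (suc i) n (hookTab c S T) ((r ∷ ra) ∷ legs))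
      (trans (modifyAt-singletons (replicate (suc (length T)) 0 ++ rb) (length T) (n ∸ i))
        (cong (map [_]) (modifyAt-replicate (length T) (n ∸ i) 0 rb))))

evacuatedHook : ℕ → ℕ → List ℕ → List ℕ → List ℕ → List ℕ → Tab
evacuatedHook n i S T ra rb =
  hookTab (n ∸ (i + (length S + length T)))
    (reverse (map (2 + n ∸_) S) ++ ra) (reverse (map (2 + n ∸_) T) ++ rb)

evacuatedHook-arm : ∀ n i S T ra rb →
  evacuatedHook n (suc i) S T (n ∸ i ∷ ra) rb ≡ evacuatedHook n i (2 + i ∷ S) T ra rb
evacuatedHook-arm n i S T ra rb =
  cong₂ (λ m arm → hookTab (n ∸ m) arm (reverse (map (2 + n ∸_) T) ++ rb))
    (sym (+-suc i _)) (sym (reverse-∷-++ (map (2 + n ∸_) S) (n ∸ i) ra))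

evacuatedHook-leg : ∀ n i S T ra rb →
  evacuatedHook n (suc i) S T ra (n ∸ i ∷ rb) ≡ evacuatedHook n i S (2 + i ∷ T) ra rb
evacuatedHook-leg n i S T ra rb =
  cong₂ (λ m leg → hookTab (n ∸ m) (reverse (map (2 + n ∸_) S) ++ ra) leg)
    (trans (sym (+-suc i _)) (cong (i +_) (sym (+-suc (length S) (length T)))))
    (sym (reverse-∷-++ (map (2 + n ∸_) T) (n ∸ i) rb))

-- Step i removes the entry c = 2 + i and writes n ∸ i = (2 + n) ∸ c into the last
-- still unwritten (zero) cell of the arm or of the leg of the recording tableau.
evacAux-hookTab : ∀ f i n x S T r ra rb L → Increasing S → Increasing T →
  S ++ T ↭ range (2 + i) L → x < 2 + i → length S + length T < f →
  evacAux f i n (hookTab x S T) (hookTab r (replicate (length S) 0 ++ ra) (replicate (length T) 0 ++ rb)) ≡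
    evacuatedHook n i S T ra rb
evacAux-hookTab (suc f) i n x [] [] r ra rb L _ _ _ _ _
  rewrite +-identityʳ i = evacAux-[] f (suc i) n _
evacAux-hookTab f i n x (a ∷ S) T r ra rb zero _ _ S++T↭ _ _ = contradiction S++T↭ ¬x∷xs↭[]
evacAux-hookTab f i n x [] (b ∷ T) r ra rb zero _ _ S++T↭ _ _ = contradiction S++T↭ ¬x∷xs↭[]
evacAux-hookTab (suc f) i n x S T r ra rb (suc L) S↑ T↑ S++T↭ x<c (s≤s fuel)
  with hookDelta L S↑ T↑ S++T↭ x<c
... | arm {S = S'} d = begin
    evacAux (suc f) i n (hookTab x (c ∷ S') T) (hookTab r (replicate (suc (length S')) 0 ++ ra) rbs)
  ≡⟨ evacAux-arm-step d ⟩
    evacAux f (suc i) n (hookTab c S' T) (hookTab r (replicate (length S') 0 ++ n ∸ i ∷ ra) rbs)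
  ≡⟨ evacAux-hookTab f (suc i) n c S' T r (n ∸ i ∷ ra) rb L (tail S↑) T↑
       (drop-∷ S++T↭) (n<1+n c) fuel ⟩
    evacuatedHook n (suc i) S' T (n ∸ i ∷ ra) rb
  ≡⟨ evacuatedHook-arm n i S' T ra rb ⟩
    evacuatedHook n i (c ∷ S') T ra rb
  ∎
  where
  open ≡-Reasoning
  c = 2 + i
  rbs = replicate (length T) 0 ++ rb
... | leg {T = T'} d = begin
    evacAux (suc f) i n (hookTab x S (c ∷ T')) (hookTab r ras (replicate (suc (length T')) 0 ++ rb))
  ≡⟨ evacAux-leg-step d ⟩
    evacAux f (suc i) n (hookTab c S T') (hookTab r ras (replicate (length T') 0 ++ n ∸ i ∷ rb))
  ≡⟨ evacAux-hookTab f (suc i) n c S T' r ra (n ∸ i ∷ rb) L S↑ (tail T↑)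
       (drop-∷ (↭-trans (↭-sym (shift c S T')) S++T↭)) (n<1+n c)
       (subst (_≤ f) (+-suc (length S) (length T')) fuel) ⟩
    evacuatedHook n (suc i) S T' ra (n ∸ i ∷ rb)
  ≡⟨ evacuatedHook-leg n i S T' ra rb ⟩
    evacuatedHook n i S (c ∷ T') ra rb
  ∎
  where
  open ≡-Reasoning
  c = 2 + i
  ras = replicate (length S) 0 ++ ra

zeros-hookTab : ∀ x S T →
  map (map (const 0)) (hookTab x S T) ≡
    hookTab 0 (replicate (length S) 0 ++ []) (replicate (length T) 0 ++ [])
zeros-hookTab x S T = cong₂ (λ arm legs → (0 ∷ arm) ∷ legs)
  (trans (map-const 0 S) (sym (++-identityʳ _)))
  (trans (zeros-leg T) (cong (map [_]) (trans (map-const 0 T) (sym (++-identityʳ _)))))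
  where
  zeros-leg : ∀ T → map (map (const 0)) (map [_] T) ≡ map [_] (map (const 0) T)
  zeros-leg []      = refl
  zeros-leg (t ∷ T) = cong ([ 0 ] ∷_) (zeros-leg T)

evac-hookTab : ∀ m {S T} → Increasing S → Increasing T → length S + length T ≡ m →
  S ++ T ↭ range 2 m →
  evac (hookTab 1 S T) ≡ hookTab 1 (reverse (map (3 + m ∸_) S)) (reverse (map (3 + m ∸_) T))
evac-hookTab m {S} {T} S↑ T↑ refl S++T↭ = begin
    evac (hookTab 1 S T)
  ≡⟨ cong (evacAux N 0 N (hookTab 1 S T)) (zeros-hookTab 1 S T) ⟩
    evacAux N 0 N (hookTab 1 S T) (hookTab 0 (replicate (length S) 0 ++ []) (replicate (length T) 0 ++ []))
  ≡⟨ evacAux-hookTab N 0 N 1 S T 0 [] [] m S↑ T↑ S++T↭ (s≤s (s≤s z≤n))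
       (≤-reflexive (sym (size-hookTab 1 S T))) ⟩
    hookTab (N ∸ m) (reverse (map (2 + N ∸_) S) ++ []) (reverse (map (2 + N ∸_) T) ++ [])
  ≡⟨ cong (λ N → hookTab (N ∸ m) (reverse (map (2 + N ∸_) S) ++ []) (reverse (map (2 + N ∸_) T) ++ []))
       (size-hookTab 1 S T) ⟩
    hookTab (suc m ∸ m) (reverse (map (3 + m ∸_) S) ++ []) (reverse (map (3 + m ∸_) T) ++ [])
  ≡⟨ cong₂ (hookTab (suc m ∸ m)) (++-identityʳ _) (++-identityʳ _) ⟩
    hookTab (suc m ∸ m) (reverse (map (3 + m ∸_) S)) (reverse (map (3 + m ∸_) T))
  ≡⟨ cong (λ y → hookTab y (reverse (map (3 + m ∸_) S)) (reverse (map (3 + m ∸_) T))) (m+n∸n≡m 1 m) ⟩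
    hookTab 1 (reverse (map (3 + m ∸_) S)) (reverse (map (3 + m ∸_) T))
  ∎
  where
  open ≡-Reasoning
  N = size (hookTab 1 S T)

-- Standard hook tableaux

linked-by-lookupL : ∀ l → (∀ r {a b} → lookupL l r ≡ just a → lookupL l (suc r) ≡ just b → a < b) →
  Linked _<_ l
linked-by-lookupL []          _    = []
linked-by-lookupL (a ∷ [])    _    = [-]
linked-by-lookupL (a ∷ b ∷ l) a<b = a<b 0 refl refl ∷ linked-by-lookupL (b ∷ l) (a<b ∘ suc)

IsSYT-arm : ∀ {n x S T} → IsSYT n (hookTab x S T) → Increasing (x ∷ S)
IsSYT-arm (_ , x∷S↑ ∷ _ , _) = Linked⇒AllPairs <-trans x∷S↑

IsSYT-leg : ∀ {n x S T} → IsSYT n (hookTab x S T) → Increasing (x ∷ T)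
IsSYT-leg {x = x} {S} {T} (_ , _ , columns↑ , _) =
  Linked⇒AllPairs <-trans (linked-by-lookupL (x ∷ T) (λ r e₁ e₂ →
    columns↑ r 0 _ _ (trans (entry-column₀ x S T r) e₁) (trans (entry-column₀ x S T (suc r)) e₂)))

IsSYT-entries : ∀ {n x S T} → IsSYT n (hookTab x S T) → x ∷ S ++ T ↭ range 1 n
IsSYT-entries {n} {x} {S} {T} (_ , _ , _ , entries) =
  subst₂ _↭_ (cong (λ leg → x ∷ S ++ leg) (concat-map-[ T ])) (applyUpTo-range suc 1 n (λ _ → refl))
    entries

corner≡1 : ∀ {x S T L} → Increasing (x ∷ S) → Increasing (x ∷ T) → x ∷ S ++ T ↭ range 1 L →
  x ≡ 1
corner≡1 {L = zero}                _         _         entries = contradiction entries ¬x∷xs↭[]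
corner≡1 {x} {S} {T} {L = suc L} (x<S ∷ _) (x<T ∷ _) entries with ∈-resp-↭ (↭-sym entries) (here refl)
... | here 1≡x  = sym 1≡x
... | there 1∈ = contradiction (range-lower 1 (suc L) (∈-resp-↭ entries (here refl))) (<⇒≱ x<1)
  where
  x<1 : x < 1
  x<1 with ∈-++⁻ S 1∈
  ... | inj₁ 1∈S = All.lookup x<S 1∈S
  ... | inj₂ 1∈T = All.lookup x<T 1∈T

transposeT-evac-hookTab≡⇔ : ∀ m {S T} → Increasing S → Increasing T → length S + length T ≡ m →
  S ++ T ↭ range 2 m →
  transposeT (evac (hookTab 1 S T)) ≡ hookTab 1 S T ⇔ reverse (map (3 + m ∸_) S) ≡ T
transposeT-evac-hookTab≡⇔ m {S} {T} S↑ T↑ |S|+|T|≡m S++T↭ = mk⇔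
  (λ self → proj₂ (hookTab-injective (trans (sym transposed-evac) self)))
  (λ S↦T → trans transposed-evac (cong₂ (hookTab 1) (T↦S S↦T) S↦T))
  where
  transposed-evac :
    transposeT (evac (hookTab 1 S T)) ≡ hookTab 1 (reverse (map (3 + m ∸_) T)) (reverse (map (3 + m ∸_) S))
  transposed-evac =
    trans (cong transposeT (evac-hookTab m S↑ T↑ |S|+|T|≡m S++T↭)) (transposeT-hookTab 1 _ _)
  S≤ : All (_≤ 3 + m) S
  S≤ = All.tabulate (λ i∈S →
    ≤-trans (proj₂ (range-bounds 1 m (∈-resp-↭ S++T↭ (∈-++⁺ˡ i∈S)))) (m≤n+m (suc m) 2))
  T↦S : reverse (map (3 + m ∸_) S) ≡ T → reverse (map (3 + m ∸_) T) ≡ S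
  T↦S refl = reverse-map-∸-involutive (3 + m) S≤

first-row-condition⇔ : ∀ n {S T} → All (λ i → 1 < i × i ≤ n) S →
  (∀ {i} → i ∈ S → 2 + n ∸ i ∈ T) ⇔
  (∀ i → 1 < i → i ≤ n → i ∈ firstRow (hookTab 1 S T) → (n ∸ i + 2) ∈ firstCol (hookTab 1 S T))
first-row-condition⇔ n {S} {T} S-bounds = mk⇔ to from
  where
  Reflected RowToColumn : Set
  Reflected   = ∀ {i} → i ∈ S → 2 + n ∸ i ∈ T
  RowToColumn = ∀ i → 1 < i → i ≤ n → i ∈ 1 ∷ S → (n ∸ i + 2) ∈ firstCol (hookTab 1 S T)
  reflection : ∀ {i} → i ≤ n → n ∸ i + 2 ≡ 2 + n ∸ i
  reflection {i} i≤n = sym (trans (cong (_∸ i) (+-comm 2 n)) (+-∸-comm 2 i≤n))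
  to : Reflected → RowToColumn
  to S→T i 1<i i≤n (here refl) = contradiction 1<i (<-irrefl refl)
  to S→T i 1<i i≤n (there i∈S) = subst (n ∸ i + 2 ∈_) (sym (firstCol-hookTab 1 S T))
    (there (subst (_∈ T) (sym (reflection i≤n)) (S→T i∈S)))
  from : RowToColumn → Reflected
  from row→col {i} i∈S with All.lookup S-bounds i∈S
  ... | 1<i , i≤n = subst (_∈ T) (reflection i≤n)
    (∈-tail (subst (n ∸ i + 2 ∈_) (firstCol-hookTab 1 S T) (row→col i 1<i i≤n (there i∈S)))
            (<⇒≢ (m≤n+m 2 (n ∸ i))))

lemma4p6 : (k : ℕ) (P : Tab) → IsSYT (suc (2 * k)) P → shape P ≡ hook k →
    (transposeT (evac P) ≡ P ⇔
    (∀ i → 1 < i → i ≤ suc (2 * k) → i ∈ firstRow P → (suc (2 * k) ∸ i + 2) ∈ firstCol P))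
lemma4p6 k P syt shape≡hook with hook-shaped shape≡hook
... | hookShaped x {S} {T} |S|≡k |T|≡k with corner≡1 (IsSYT-arm syt) (IsSYT-leg syt) (IsSYT-entries syt)
... | refl =
  ⇔-trans (transposeT-evac-hookTab≡⇔ (2 * k) S↑ T↑ |S|+|T|≡2k S++T↭)
  (⇔-trans (reverse-map-∸≡⇔ (3 + 2 * k) S↑ T↑ S≤ (trans |S|≡k (sym |T|≡k)))
           (first-row-condition⇔ (suc (2 * k)) S-bounds))
  where
  S↑ : Increasing S
  S↑ = tail (IsSYT-arm syt)
  T↑ : Increasing T
  T↑ = tail (IsSYT-leg syt)
  S++T↭ : S ++ T ↭ range 2 (2 * k)
  S++T↭ = drop-∷ (IsSYT-entries syt)
  |S|+|T|≡2k : length S + length T ≡ 2 * k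
  |S|+|T|≡2k = trans (cong₂ _+_ |S|≡k |T|≡k) (cong (k +_) (sym (+-identityʳ k)))
  S-bounds : All (λ i → 1 < i × i ≤ suc (2 * k)) S
  S-bounds = All.tabulate (λ i∈S → range-bounds 1 (2 * k) (∈-resp-↭ S++T↭ (∈-++⁺ˡ i∈S)))
  S≤ : All (_≤ 3 + 2 * k) S
  S≤ = All.map (λ (_ , i≤n) → m≤n⇒m≤1+n (m≤n⇒m≤1+n i≤n)) S-bounds
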